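{- Let $\mathsf{CS}$ be any constant specification for $\mathsf{LPC}^+$. The rule "from $\phi\equiv\psi$ infer $t{:}\phi\equiv t{:}\psi$" is not validity preserving in $\mathsf{LPC}^+_{\mathsf{CS}}$: there exist formulas $\phi,\psi$ and a term $t$ such that $\vDash_{\mathsf{LPC}^+_{\mathsf{CS}}}\phi\equiv\psi$ but $\not\vDash_{\mathsf{LPC}^+_{\mathsf{CS}}} t{:}\phi\equiv t{:}\psi$.
   Context: $\phi\equiv\psi$ abbreviates $(\phi\supset\psi)\wedge(\psi\supset\phi)$. Language: countable sets $\mathsf{Const}$, $\mathsf{Var}$, $\mathsf{Prop}$; terms $t ::= c \mid x \mid t\cdot t \mid t+t \mid\ !t$; formulas $\phi ::= p \mid \neg\phi \mid \phi\wedge\phi \mid \phi\supset\phi \mid \phi>\phi \mid t{:}\phi$. Axiom schemes of $\mathsf{LPC}^+$: (A1) classical tautologies; (A2) $(\phi>(\psi\supset\chi))\supset((\phi>\psi)\supset(\phi>\chi))$; (A3) $\phi>\phi$; (A4) $(\phi>\psi)\supset(\phi\supset\psi)$; (A5) $(s{:}(\phi>\psi)\wedge t{:}\phi)>(s\cdot t){:}\psi$; (A6) $s{:}\phi>(s+t){:}\phi$; (A7) $t{:}\phi>(s+t){:}\phi$; (A8) $t{:}\phi>\phi$; (A9) $t{:}\phi>{!t}{:}t{:}\phi$. A constant specification $\mathsf{CS}$ is a set of formulas $c{:}\phi$, $c\in\mathsf{Const}$, $\phi$ an instance of (A1)–(A9). Relational model: $\mathcal M=(W,W_N,R_{Fm},R_{Tm},V)$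 with $W$ nonempty, $\emptyset\ne W_N\subseteq W$; $R_\phi\subseteq W_N\times W_N$ for each formula $\phi$; $R_t\subseteq W\times W$ for each term $t$; $V$ maps each $w\in W_N$ to a subset of $\mathsf{Prop}$ and each $w\in W\setminus W_N$ to a set of formulas. $R_\phi(w)=\{v:wR_\phi v\}$, $R_t(w)=\{v:wR_tv\}$, $[\![\phi]\!]=\{w\in W:(\mathcal M,w)\vDash\phi\}$. Truth: for $w\in W\setminus W_N$, $(\mathcal M,w)\vDash\phi$ iff $\phi\in V(w)$; for $w\in W_N$: $p$ iff $p\in V(w)$; $\neg,\wedge,\supset$ classically; $\phi>\psi$ iff $R_\phi(w)\subseteq[\![\psi]\!]$; $t{:}\phi$ iff $R_t(w)\subseteq[\![\phi]\!]$. An $\mathsf{LPC}^+_{\mathsf{CS}}$-model satisfies for all $w\in W_N$: (1) $R_\phi(w)\subseteq[\![\phi]\!]$; (2) $w\in[\![\phi]\!]$ implies $w\in R_\phi(w)$; (3) $R_c(w)\subseteq[\![\phi]\!]$ for $c{:}\phi\in\mathsf{CS}$; (4) $R_{s+t}(w)\subseteq R_s(w)\cap R_t(w)$; (5) $R_{s\cdot t}(w)\subseteq\{v\in W:$ for all $\phi,\psi$, if $w\in[\![s{:}(\phi>\psi)\wedge t{:}\phi]\!]$ then $v\in[\![\psi]\!]\}$; (6) $wR_tw$ for all $t$; (7) for all $t$, $v,u\in W$: $wR_{!t}v$ and $vR_tu$ imply $wR_tu$. $\vDash_{\mathsf{LPC}^+_{\mathsf{CS}}}\phi$: $\phi$ true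 at every normal state of every $\mathsf{LPC}^+_{\mathsf{CS}}$-model. -}

module Defs where

open import Data.Nat using (ℕ)
open import Data.Bool using (Bool; true; false; not; _∧_; _∨_)
open import Data.Product using (_×_; _,_; Σ)
open import Data.Sum using (_⊎_; inj₁; inj₂)
open import Relation.Binary.PropositionalEquality using (_≡_)
open import Relation.Nullary using (¬_)

Const Var Prop : Set
Const = ℕ
Var = ℕ
Prop = ℕ

data Tm : Set where
  const : Const → Tm
  var   : Var → Tm
  _·_   : Tm → Tm → Tm
  _⊕_   : Tm → Tm → Tm
  !_    : Tm → Tm

infixr 6 _∧ᶠ_
infixr 5 _⊃_ _▷_
infix 7 _∶_
data Fm : Set where
  atom  : Prop → Fm
  ¬ᶠ_   : Fm → Fm
  _∧ᶠ_  : Fm → Fm → Fm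
  _⊃_   : Fm → Fm → Fm
  _▷_   : Fm → Fm → Fm
  _∶_   : Tm → Fm → Fm

_≡ᶠ_ : Fm → Fm → Fm
φ ≡ᶠ ψ = (φ ⊃ ψ) ∧ᶠ (ψ ⊃ φ)

-- Classical tautologies: formulas true under every Boolean valuation in which
-- the non-Boolean formulas (atoms, φ > ψ, t : φ) are treated as propositional atoms.
evalB : (Fm → Bool) → Fm → Bool
evalB f (atom p) = f (atom p)
evalB f (¬ᶠ φ) = not (evalB f φ)
evalB f (φ ∧ᶠ ψ) = evalB f φ ∧ evalB f ψ
evalB f (φ ⊃ ψ) = not (evalB f φ) ∨ evalB f ψ
evalB f (φ ▷ ψ) = f (φ ▷ ψ)
evalB f (t ∶ φ) = f (t ∶ φ)

Tautology : Fm → Set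
Tautology φ = (f : Fm → Bool) → evalB f φ ≡ true

data Axiom : Fm → Set where
  A1 : ∀ {φ} → Tautology φ → Axiom φ
  A2 : ∀ φ ψ χ → Axiom ((φ ▷ (ψ ⊃ χ)) ⊃ ((φ ▷ ψ) ⊃ (φ ▷ χ)))
  A3 : ∀ φ → Axiom (φ ▷ φ)
  A4 : ∀ φ ψ → Axiom ((φ ▷ ψ) ⊃ (φ ⊃ ψ))
  A5 : ∀ s t φ ψ → Axiom (((s ∶ (φ ▷ ψ)) ∧ᶠ (t ∶ φ)) ▷ ((s · t) ∶ ψ))
  A6 : ∀ s t φ → Axiom ((s ∶ φ) ▷ ((s ⊕ t) ∶ φ))
  A7 : ∀ s t φ → Axiom ((t ∶ φ) ▷ ((s ⊕ t) ∶ φ))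
  A8 : ∀ t φ → Axiom ((t ∶ φ) ▷ φ)
  A9 : ∀ t φ → Axiom ((t ∶ φ) ▷ ((! t) ∶ (t ∶ φ)))

-- A constant specification: a set of formulas c : φ with φ an axiom instance.
-- CS c φ  means  (c : φ) ∈ CS.
record ConstSpec : Set₁ where
  field
    CS      : Const → Fm → Set
    isAxiom : ∀ c φ → CS c φ → Axiom φ
open ConstSpec public

-- Relational models. W = WN ⊎ WA, where WN are the normal states (nonempty)
-- and WA = W \ WN the non-normal states.
record Model : Set₁ where
  field
    WN   : Set
    WA   : Set
    w₀   : WN                                  -- W_N ≠ ∅
    RF   : Fm → WN → WN → Set
    RT   : Tm → (WN ⊎ WA) → (WN ⊎ WA) → Set
    VN   : WN → Prop → Set
    VA   : WA → Fm → Set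
open Model public

W : Model → Set
W M = WN M ⊎ WA M

sat : (M : Model) → Fm → W M → Set
sat M φ (inj₂ a) = VA M a φ
sat M (atom p) (inj₁ w) = VN M w p
sat M (¬ᶠ φ) (inj₁ w) = ¬ sat M φ (inj₁ w)
sat M (φ ∧ᶠ ψ) (inj₁ w) = sat M φ (inj₁ w) × sat M ψ (inj₁ w)
sat M (φ ⊃ ψ) (inj₁ w) = sat M φ (inj₁ w) → sat M ψ (inj₁ w)
sat M (φ ▷ ψ) (inj₁ w) = ∀ v → RF M φ w v → sat M ψ (inj₁ v)
sat M (t ∶ φ) (inj₁ w) = ∀ u → RT M t (inj₁ w) u → sat M φ u

record IsLPCModel (C : ConstSpec) (M : Model) : Set where
  field
    c1 : ∀ φ (w v : WN M) → RF M φ w v → sat M φ (inj₁ v)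
    c2 : ∀ φ (w : WN M) → sat M φ (inj₁ w) → RF M φ w w
    c3 : ∀ c φ → CS C c φ → ∀ (w : WN M) u → RT M (const c) (inj₁ w) u → sat M φ u
    c4 : ∀ s t (w : WN M) u → RT M (s ⊕ t) (inj₁ w) u →
           RT M s (inj₁ w) u × RT M t (inj₁ w) u
    c5 : ∀ s t (w : WN M) v → RT M (s · t) (inj₁ w) v →
           ∀ φ ψ → sat M ((s ∶ (φ ▷ ψ)) ∧ᶠ (t ∶ φ)) (inj₁ w) → sat M ψ v
    c6 : ∀ t (w : WN M) → RT M t (inj₁ w) (inj₁ w)
    c7 : ∀ t (w : WN M) (v u : W M) → RT M (! t) (inj₁ w) v → RT M t v u →
           RT M t (inj₁ w) u

Valid : ConstSpec → Fm → Set₁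
Valid C φ = (M : Model) → IsLPCModel C M → (w : WN M) → sat M φ (inj₁ w)

-- Validity only constrains what holds at normal states, while the
-- justification operator also looks at non-normal states, whose valuation is
-- an arbitrary set of formulas.  A single normal state w that sees, via the
-- variable x₀ only, a non-normal state a with V(a) = {p₀}, makes x₀ : p₀ true
-- and x₀ : (p₀ ∧ p₀) false, although p₀ ≡ (p₀ ∧ p₀) is valid.  Elsewhere the
-- model is trivial: at w every atom holds, φ > ψ is material implication and
-- t : φ means φ, so all axiom instances, hence all constant specifications,
-- are true there.
module Submission where

open import Defs
open import Data.Bool using (Bool; true; false; not; _∧_; _∨_; T)
open import Data.Bool.Properties using (T-∧; T-≡)
open import Data.Empty using (⊥)
open import Data.Nat using (zero)
open import Data.Product using (Σ; _×_; _,_; proj₁; proj₂)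
open import Data.Sum using (_⊎_; inj₁; inj₂)
open import Data.Unit using (⊤; tt)
open import Function using (_∘_)
open import Function.Bundles using (_⇔_; mk⇔; Equivalence)
open import Relation.Binary.PropositionalEquality using (_≡_; refl; cong; cong₂; subst)
open import Relation.Nullary using (¬_)

open Equivalence using (to; from)

_⇒ᵇ_ : Bool → Bool → Bool
a ⇒ᵇ b = not a ∨ b

⇒ᵇ-intro : ∀ a {b} → (T a → T b) → T (a ⇒ᵇ b)
⇒ᵇ-intro true  f = f tt
⇒ᵇ-intro false f = tt

⇒ᵇ-elim : ∀ {a b} → T (a ⇒ᵇ b) → T a → T b
⇒ᵇ-elim {true} h _ = h

x₀ : Tm
x₀ = var zero

p₀ : Fm
p₀ = atom zero

is-x₀ : Tm → Bool
is-x₀ (var zero) = true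
is-x₀ _          = false

is-p₀ : Fm → Bool
is-p₀ (atom zero) = true
is-p₀ _           = false

value : Fm → Bool
value (atom p) = true
value (¬ᶠ φ)   = not (value φ)
value (φ ∧ᶠ ψ) = value φ ∧ value ψ
value (φ ⊃ ψ)  = value φ ⇒ᵇ value ψ
value (φ ▷ ψ)  = value φ ⇒ᵇ value ψ
value (t ∶ φ)  = value φ ∧ (is-x₀ t ⇒ᵇ is-p₀ φ)

evalB-value : ∀ φ → evalB value φ ≡ value φ
evalB-value (atom p) = refl
evalB-value (¬ᶠ φ)   = cong not (evalB-value φ)
evalB-value (φ ∧ᶠ ψ) = cong₂ _∧_ (evalB-value φ) (evalB-value ψ)
evalB-value (φ ⊃ ψ)  = cong₂ _⇒ᵇ_ (evalB-value φ) (evalB-value ψ)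
evalB-value (φ ▷ ψ)  = refl
evalB-value (t ∶ φ)  = refl

value-tautology : ∀ {φ} → Tautology φ → T (value φ)
value-tautology {φ} taut = from T-≡ (subst (_≡ true) (evalB-value φ) (taut value))

value-axiom : ∀ {φ} → Axiom φ → T (value φ)
value-axiom {φ} (A1 taut) = value-tautology {φ} taut
value-axiom (A2 φ ψ χ)    =
  ⇒ᵇ-intro (value (φ ▷ (ψ ⊃ χ))) λ h →
  ⇒ᵇ-intro (value (φ ▷ ψ)) λ h′ →
  ⇒ᵇ-intro (value φ) λ x →
    ⇒ᵇ-elim (⇒ᵇ-elim {value φ} h x) (⇒ᵇ-elim {value φ} h′ x)
value-axiom (A3 φ)        = ⇒ᵇ-intro (value φ) λ x → x
value-axiom (A4 φ ψ)      = ⇒ᵇ-intro (value (φ ▷ ψ)) λ h → h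
value-axiom (A5 s t φ ψ)  = ⇒ᵇ-intro (value ((s ∶ (φ ▷ ψ)) ∧ᶠ (t ∶ φ))) λ h →
  let hs , ht = to T-∧ h
  in from T-∧ (⇒ᵇ-elim {value φ} (proj₁ (to T-∧ hs)) (proj₁ (to T-∧ ht)) , tt)
value-axiom (A6 s t φ)    = ⇒ᵇ-intro (value (s ∶ φ)) λ h → from T-∧ (proj₁ (to T-∧ h) , tt)
value-axiom (A7 s t φ)    = ⇒ᵇ-intro (value (t ∶ φ)) λ h → from T-∧ (proj₁ (to T-∧ h) , tt)
value-axiom (A8 t φ)      = ⇒ᵇ-intro (value (t ∶ φ)) λ h → proj₁ (to T-∧ h)
value-axiom (A9 t φ)      = ⇒ᵇ-intro (value (t ∶ φ)) λ h → from T-∧ (h , tt)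

-- The normal state is inj₁ tt and the non-normal state inj₂ tt.
justifies : Tm → ⊤ ⊎ ⊤ → ⊤ ⊎ ⊤ → Set
justifies t (inj₁ _) (inj₁ _) = ⊤
justifies t (inj₁ _) (inj₂ _) = T (is-x₀ t)
justifies t (inj₂ _) _        = ⊥

countermodel : Model
countermodel = record
  { WN = ⊤
  ; WA = ⊤
  ; w₀ = tt
  ; RF = λ φ _ _ → T (value φ)
  ; RT = justifies
  ; VN = λ _ _ → ⊤
  ; VA = λ _ φ → T (is-p₀ φ)
  }

⊨_ : Fm → Set
⊨ φ = sat countermodel φ (inj₁ tt)

truth : ∀ φ → ⊨ φ ⇔ T (value φ)
truth (atom p) = mk⇔ (λ _ → tt) (λ _ → tt)
truth (¬ᶠ φ) with value φ | truth φ
... | true  | IH = mk⇔ (λ h → h (from IH tt)) λ ()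
... | false | IH = mk⇔ (λ _ → tt) (λ _ → to IH)
truth (φ ∧ᶠ ψ) = mk⇔
  (λ (x , y) → from T-∧ (to (truth φ) x , to (truth ψ) y))
  (λ h → let x , y = to T-∧ h in from (truth φ) x , from (truth ψ) y)
truth (φ ⊃ ψ) = mk⇔
  (λ h → ⇒ᵇ-intro (value φ) (to (truth ψ) ∘ h ∘ from (truth φ)))
  (λ h → from (truth ψ) ∘ ⇒ᵇ-elim h ∘ to (truth φ))
truth (φ ▷ ψ) = mk⇔
  (λ h → ⇒ᵇ-intro (value φ) (to (truth ψ) ∘ h tt))
  (λ h _ → from (truth ψ) ∘ ⇒ᵇ-elim h)
truth (t ∶ φ) = mk⇔
  (λ h → from T-∧ (to (truth φ) (h (inj₁ tt) tt) , ⇒ᵇ-intro (is-x₀ t) (h (inj₂ tt))))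
  λ { h (inj₁ tt) _ → from (truth φ) (proj₁ (to T-∧ h))
    ; h (inj₂ tt) x → ⇒ᵇ-elim (proj₂ (to (T-∧ {value φ}) h)) x }

-- Only variables reach the non-normal state, so conditions (3), (4), (5) and
-- (7) reduce to the normal state, where they hold by the truth lemma.
countermodel-isLPC : (C : ConstSpec) → IsLPCModel C countermodel
countermodel-isLPC C = record
  { c1 = λ φ _ _ → from (truth φ)
  ; c2 = λ φ _ → to (truth φ)
  ; c3 = constants-sound
  ; c4 = sum-sound
  ; c5 = application-sound
  ; c6 = λ _ _ → tt
  ; c7 = proof-checker-sound
  }
  where
  constants-sound : ∀ c φ → CS C c φ → ∀ w u → justifies (const c) (inj₁ w) u →
                    sat countermodel φ u
  constants-sound c φ cs _ (inj₁ _) _ = from (truth φ) (value-axiom (isAxiom C c φ cs))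

  sum-sound : ∀ s t w u → justifies (s ⊕ t) (inj₁ w) u →
              justifies s (inj₁ w) u × justifies t (inj₁ w) u
  sum-sound s t _ (inj₁ _) _ = tt , tt

  application-sound : ∀ s t w v → justifies (s · t) (inj₁ w) v →
                      ∀ φ ψ → ⊨ ((s ∶ (φ ▷ ψ)) ∧ᶠ (t ∶ φ)) → sat countermodel ψ v
  application-sound s t _ (inj₁ _) _ φ ψ (hs , ht) =
    hs (inj₁ tt) tt tt (to (truth φ) (ht (inj₁ tt) tt))

  proof-checker-sound : ∀ t w v u → justifies (! t) (inj₁ w) v → justifies t v u →
                        justifies t (inj₁ w) u
  proof-checker-sound t _ (inj₁ _) _ _ r = r

lemma3 : (C : ConstSpec) →
    Σ Fm (λ φ → Σ Fm (λ ψ → Σ Tm (λ t →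
    Valid C (φ ≡ᶠ ψ) × ¬ Valid C ((t ∶ φ) ≡ᶠ (t ∶ ψ)))))
lemma3 C = p₀ , p₀ ∧ᶠ p₀ , x₀ , p₀≡p₀∧p₀-valid , x₀-distinguishes
  where
  p₀≡p₀∧p₀-valid : Valid C (p₀ ≡ᶠ (p₀ ∧ᶠ p₀))
  p₀≡p₀∧p₀-valid _ _ _ = (λ x → x , x) , proj₁

  x₀-distinguishes : ¬ Valid C ((x₀ ∶ p₀) ≡ᶠ (x₀ ∶ (p₀ ∧ᶠ p₀)))
  x₀-distinguishes valid = x₀∶p₀∧p₀-true (inj₂ tt) tt
    where
    x₀∶p₀∧p₀-true : ⊨ (x₀ ∶ (p₀ ∧ᶠ p₀))
    x₀∶p₀∧p₀-true = proj₁ (valid countermodel (countermodel-isLPC C) tt) (from (truth (x₀ ∶ p₀)) tt)
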